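{- Let $k\ge 1$, let $\mathbf q=(q_1,\dots,q_k)\in\mathbb Z_{>0}^k$, and let $b\geq 2$ be an integer. Let $S^o=\sum_{i\text{ odd},\,1\le i\le k}q_i$, $S^e=\sum_{i\text{ even},\,1\le i\le k}q_i$, and let $A_k$ be the upper-left entry of the matrix $\prod_{i=1}^{k}\begin{pmatrix}q_i&1\\1&0\end{pmatrix}$. If $S^o>b$ and $S^e>b$, then $A_k>b^2$. -}

module Defs where

open import Data.Nat using (ℕ; zero; suc; _+_; _*_)
open import Data.Product using (_×_; _,_; proj₁)
open import Data.Vec using (Vec; []; _∷_)

-- 2×2 matrices over ℕ, entries (a , b , c , d) = [[a , b] , [c , d]]
Mat2 : Set
Mat2 = ℕ × ℕ × ℕ × ℕ

I₂ : Mat2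
I₂ = (1 , 0 , 0 , 1)

_⊗_ : Mat2 → Mat2 → Mat2
(a , b , c , d) ⊗ (e , f , g , h) =
  (a * e + b * g , a * f + b * h , c * e + d * g , c * f + d * h)

M : ℕ → Mat2
M q = (q , 1 , 1 , 0)

prodM : ∀ {k} → Vec ℕ k → Mat2
prodM [] = I₂
prodM (q ∷ qs) = M q ⊗ prodM qs

A : ∀ {k} → Vec ℕ k → ℕ
A qs = proj₁ (prodM qs)

-- With 1-based indexing q = (q₁ , q₂ , …):
-- Sᵒ = q₁ + q₃ + q₅ + ⋯ ,  Sᵉ = q₂ + q₄ + ⋯  (mutually recursive)
Sᵒ : ∀ {k} → Vec ℕ k → ℕ
Sᵉ : ∀ {k} → Vec ℕ k → ℕ
Sᵒ [] = 0
Sᵒ (q ∷ qs) = q + Sᵉ qs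
Sᵉ [] = 0
Sᵉ (q ∷ qs) = Sᵒ qs

-- Write A, C for the left column of the continuant product and Sᵒ, Sᵉ for the
-- alternating sums. Prepending q ≥ 1 maps (A, C) to (q A + C, A) and (Sᵒ, Sᵉ)
-- to (q + Sᵉ, Sᵒ), which preserves 1 ≤ A, Sᵒ ≤ A, Sᵉ ≤ C and Sᵒ Sᵉ < A + Sᵉ.
-- With b < Sᵒ and b < Sᵉ the last inequality gives (b + 1) Sᵉ < A + Sᵉ, hence b² < A.
module Submission where

open import Defs
open import Data.Nat using (ℕ; suc; _<_; _≤_; _*_; _+_; z≤n; s≤s; >-nonZero)
open import Data.Nat.Properties
open import Data.Nat.Tactic.RingSolver using (solve-∀)
open import Data.Product using (_,_; proj₁; proj₂)
open import Data.Vec using (Vec; []; _∷_)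
open import Data.Vec.Relation.Unary.All using (All; []; _∷_)
open import Relation.Binary.PropositionalEquality using (_≡_; cong; subst; sym; trans)

C : ∀ {k} → Vec ℕ k → ℕ
C qs = proj₁ (proj₂ (proj₂ (prodM qs)))

A-∷ : ∀ {k} q (qs : Vec ℕ k) → A (q ∷ qs) ≡ q * A qs + C qs
A-∷ q qs = cong (q * A qs +_) (*-identityˡ (C qs))

C-∷ : ∀ {k} q (qs : Vec ℕ k) → C (q ∷ qs) ≡ A qs
C-∷ q qs = trans (+-identityʳ (1 * A qs)) (*-identityˡ (A qs))

record Bounds {k} (q : Vec ℕ k) : Set where
  field
    A-positive : 1 ≤ A q
    Sᵒ≤A       : Sᵒ q ≤ A q
    Sᵉ≤C       : Sᵉ q ≤ C q
    Sᵒ*Sᵉ<A+Sᵉ : Sᵒ q * Sᵉ q < A q + Sᵉ q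

Sᵒ*Sᵉ<A+Sᵉ-step : ∀ p a c x y → x ≤ a → y ≤ c → x * y < a + y →
           (suc p + y) * x < suc p * a + c + x
Sᵒ*Sᵉ<A+Sᵉ-step p a c x y x≤a y≤c xy<a+y = begin-strict
  (suc p + y) * x     ≡⟨ expand p x y ⟩
  x + p * x + x * y   <⟨ +-monoʳ-< (x + p * x) xy<a+y ⟩
  x + p * x + (a + y) ≤⟨ +-mono-≤ (+-monoʳ-≤ x (*-monoʳ-≤ p x≤a)) (+-monoʳ-≤ a y≤c) ⟩
  x + p * a + (a + c) ≡⟨ regroup x p a c ⟩
  suc p * a + c + x   ∎
  where
  open ≤-Reasoning
  expand : ∀ p x y → (suc p + y) * x ≡ x + p * x + x * y
  expand = solve-∀
  regroup : ∀ x p a c → x + p * a + (a + c) ≡ suc p * a + c + x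
  regroup = solve-∀

bounds : ∀ {k} (q : Vec ℕ k) → All (1 ≤_) q → Bounds q
bounds [] [] = record
  { A-positive = ≤-refl ; Sᵒ≤A = z≤n ; Sᵉ≤C = z≤n ; Sᵒ*Sᵉ<A+Sᵉ = s≤s z≤n }
bounds (suc p ∷ qs) (_ ∷ qs≥1) = record
  { A-positive = at-A-∷ (1 ≤_)
      (≤-trans A-positive (≤-trans (m≤n*m a (suc p)) (m≤m+n (suc p * a) c)))
  ; Sᵒ≤A       = at-A-∷ (suc p + Sᵉ qs ≤_)
      (+-mono-≤ (m≤m*n (suc p) a {{>-nonZero A-positive}}) Sᵉ≤C)
  ; Sᵉ≤C       = subst (Sᵒ qs ≤_) (sym (C-∷ (suc p) qs)) Sᵒ≤A
  ; Sᵒ*Sᵉ<A+Sᵉ = at-A-∷ (λ t → (suc p + Sᵉ qs) * Sᵒ qs < t + Sᵒ qs)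
      (Sᵒ*Sᵉ<A+Sᵉ-step p a c (Sᵒ qs) (Sᵉ qs) Sᵒ≤A Sᵉ≤C Sᵒ*Sᵉ<A+Sᵉ)
  }
  where
  open Bounds (bounds qs qs≥1)
  a = A qs
  c = C qs
  at-A-∷ : (P : ℕ → Set) → P (suc p * a + c) → P (A (suc p ∷ qs))
  at-A-∷ P = subst P (sym (A-∷ (suc p) qs))

square<-of-*< : ∀ b a x y → b < x → b < y → x * y < a + y → b * b < a
square<-of-*< b a x y b<x b<y xy<a+y = +-cancelʳ-< _ _ _ (begin-strict
  b * b + y ≤⟨ +-monoˡ-≤ y (*-monoʳ-≤ b (<⇒≤ b<y)) ⟩
  b * y + y ≡⟨ +-comm (b * y) y ⟩
  suc b * y ≤⟨ *-monoˡ-≤ y b<x ⟩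
  x * y     <⟨ xy<a+y ⟩
  a + y     ∎)
  where open ≤-Reasoning

proposition4p6 : (m : ℕ) → (q : Vec ℕ (suc m)) → All (λ x → 1 ≤ x) q →
    (b : ℕ) → 2 ≤ b → b < Sᵒ q → b < Sᵉ q → b * b < A q
proposition4p6 m q q≥1 b _ b<Sᵒ b<Sᵉ =
  square<-of-*< b (A q) (Sᵒ q) (Sᵉ q) b<Sᵒ b<Sᵉ (Bounds.Sᵒ*Sᵉ<A+Sᵉ (bounds q q≥1))
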